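{- Let $B(z),C(z)$ be analytic at $z=0$ with $B(0)=C(0)=1$, and let $B\circ C(z)=B(C(z)-1)$. Then for all $n\ge k\ge 0$, \[ s_{B\circ C}(n,k)=\sum_{j=k}^{n}S_C(n,j)s_B(j,k),\qquad S_{B\circ C}(n,k)=\sum_{j=k}^{n}S_C(n,j)S_B(j,k). \] As a consequence, $s_C(n,k)=\sum_{j=k}^{n}S_C(n,j)s(j,k)$.
   Context: For $F$ analytic at $0$ with $F(0)=1$, $\log F(z)$ is the branch with $\log F(0)=0$ near $0$, and the $F$-Stirling numbers are defined by $\frac{(\log F(z))^k}{k!}=\sum_{n\ge k}s_F(n,k)\frac{z^n}{n!}$ and $\frac{(F(z)-1)^k}{k!}=\sum_{n\ge k}S_F(n,k)\frac{z^n}{n!}$. The $s(n,k)$ are the (signed) Stirling numbers of the first kind: $\frac{(\log(1+z))^k}{k!}=\sum_{n\ge k}s(n,k)\frac{z^n}{n!}$. -}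

module Defs where

open import Level using (Level; _⊔_) renaming (suc to lsuc)
open import Algebra.Bundles using (CommutativeRing)
open import Data.Nat using (ℕ; zero; suc; _∸_; _!)
import Data.Nat as N

ι : ∀ {c ℓ} (R : CommutativeRing c ℓ) → ℕ → CommutativeRing.Carrier R
ι R zero    = CommutativeRing.0# R
ι R (suc n) = CommutativeRing._+_ R (CommutativeRing.1# R) (ι R n)

-- A ℚ-algebra: a commutative ring in which every positive integer n·1 is invertible.
-- (ℂ, in which the Taylor coefficients of analytic functions live, is an instance.)
record QAlgebra (c ℓ : Level) : Set (lsuc (c ⊔ ℓ)) where
  field
    ring     : CommutativeRing c ℓ
    inv      : ℕ → CommutativeRing.Carrier ring
    inv-spec : ∀ n → CommutativeRing._≈_ ring
                 (CommutativeRing._*_ ring (ι ring (suc n)) (inv (suc n)))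
                 (CommutativeRing.1# ring)

-- Formal power series over a ℚ-algebra, represented by their (ordinary) coefficients:
-- F n is the coefficient of z^n.
module FPS {c ℓ : Level} (A : QAlgebra c ℓ) where
  open QAlgebra A public
  open CommutativeRing ring public using (Carrier; _≈_; _+_; _*_; -_; _-_; 0#; 1#)

  ιR : ℕ → Carrier
  ιR = ι ring

  Series : Set c
  Series = ℕ → Carrier

  sumLt : ℕ → (ℕ → Carrier) → Carrier
  sumLt zero    f = 0#
  sumLt (suc n) f = sumLt n f + f n

  sumTo : ℕ → (ℕ → Carrier) → Carrier
  sumTo n f = sumLt (suc n) f

  sumFromTo : ℕ → ℕ → (ℕ → Carrier) → Carrier
  sumFromTo k n f = sumTo (n ∸ k) (λ i → f (k N.+ i))

  one : Series
  one zero    = 1#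
  one (suc n) = 0#

  onePlusZ : Series
  onePlusZ zero          = 1#
  onePlusZ (suc zero)    = 1#
  onePlusZ (suc (suc n)) = 0#

  mul : Series → Series → Series
  mul F G n = sumTo n (λ i → F i * G (n ∸ i))

  pow : Series → ℕ → Series
  pow F zero    = one
  pow F (suc m) = mul F (pow F m)

  minus1 : Series → Series
  minus1 F zero    = F zero - 1#
  minus1 F (suc n) = F (suc n)

  -- composition B(G(z)) for G with G(0) = 0
  comp : Series → Series → Series
  comp B G n = sumTo n (λ m → B m * pow G m n)

  _∘ₛ_ : Series → Series → Series
  B ∘ₛ C = comp B (minus1 C)

  alt : ℕ → Carrier
  alt zero    = 1#
  alt (suc m) = - alt m

  log1p : Series → Series
  log1p G n = sumLt n (λ m → alt m * (inv (suc m) * pow G (suc m) n))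

  -- log F(z), the branch with log F(0) = 0 (for F(0) = 1)
  logS : Series → Series
  logS F = log1p (minus1 F)

  -- (log F)^k / k! = Σ_n s_F(n,k) z^n / n!
  sF : Series → ℕ → ℕ → Carrier
  sF F n k = ιR (n !) * (inv (k !) * pow (logS F) k n)

  -- (F - 1)^k / k! = Σ_n S_F(n,k) z^n / n!
  SF : Series → ℕ → ℕ → Carrier
  SF F n k = ιR (n !) * (inv (k !) * pow (minus1 F) k n)

  s : ℕ → ℕ → Carrier
  s n k = sF onePlusZ n k

-- Substitution H ↦ H ∘ G of a series G with G(0) = 0 is multiplicative, so it commutes with
-- powers and with log(1 + ·). Hence (log (B ∘ C))ᵏ = (log B)ᵏ ∘ (C − 1) and
-- (B ∘ C − 1)ᵏ = (B − 1)ᵏ ∘ (C − 1). Expanding a composition H ∘ (C − 1) coefficientwise gives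
-- [zⁿ] H ∘ (C − 1) = Σⱼ H j · [zⁿ] (C − 1)ʲ, and inserting j!/j! = 1 splits n!/k! · [zⁿ] into
-- S_C(n, j) times j!/k! · [zʲ] H; the terms j < k vanish because H is a k-th power of a series
-- without constant term. The last identity is the first one for B = 1 + z, where B ∘ C = C.
module Submission where

open import Defs
open import Level using (Level)
open import Algebra.Bundles using (CommutativeRing)
import Algebra.Solver.Ring.NaturalCoefficients.Default as Solver
open import Data.Nat using (ℕ; zero; suc; _∸_; _!; _≤_; _<_; z≤n; s≤s; s≤s⁻¹; _≟_)
  renaming (_+_ to _+ℕ_)
import Data.Nat.Properties as ℕ
open import Data.Product using (_×_; _,_)
open import Data.Empty using (⊥-elim)
open import Relation.Nullary using (Dec; yes; no; ¬_)
open import Relation.Binary.PropositionalEquality as P using (_≡_)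

module Composition {c ℓ : Level} (A : QAlgebra c ℓ) where
  open FPS A
  open CommutativeRing ring using (commutativeSemiring; setoid; refl; sym; trans; +-cong; *-cong;
    +-identityˡ; +-identityʳ; zeroˡ; zeroʳ; *-identityˡ; *-identityʳ; +-assoc; +-comm; *-assoc;
    distribˡ; distribʳ; -‿inverseʳ)
  open Solver commutativeSemiring using (solve; _:+_; _:*_; _:=_)
  open import Relation.Binary.Reasoning.Setoid setoid

  sumLt-cong-< : ∀ n {f g : ℕ → Carrier} → (∀ i → i < n → f i ≈ g i) → sumLt n f ≈ sumLt n g
  sumLt-cong-< zero    f≈g = refl
  sumLt-cong-< (suc n) f≈g =
    +-cong (sumLt-cong-< n (λ i i<n → f≈g i (ℕ.m<n⇒m<1+n i<n))) (f≈g n (ℕ.n<1+n n))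

  sumLt-cong : ∀ n {f g : ℕ → Carrier} → (∀ i → f i ≈ g i) → sumLt n f ≈ sumLt n g
  sumLt-cong n f≈g = sumLt-cong-< n (λ i _ → f≈g i)

  sumLt-≡ : ∀ {m n} (f : ℕ → Carrier) → m ≡ n → sumLt m f ≈ sumLt n f
  sumLt-≡ f P.refl = refl

  sumLt-vanishes : ∀ n {f : ℕ → Carrier} → (∀ i → i < n → f i ≈ 0#) → sumLt n f ≈ 0#
  sumLt-vanishes zero    f≈0 = refl
  sumLt-vanishes (suc n) f≈0 = begin
    sumLt n _ + _ ≈⟨ +-cong (sumLt-vanishes n (λ i i<n → f≈0 i (ℕ.m<n⇒m<1+n i<n))) (f≈0 n (ℕ.n<1+n n)) ⟩
    0# + 0#       ≈⟨ +-identityʳ 0# ⟩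
    0#            ∎

  sumLt-+ : ∀ n (f g : ℕ → Carrier) → sumLt n (λ i → f i + g i) ≈ sumLt n f + sumLt n g
  sumLt-+ zero    f g = sym (+-identityʳ 0#)
  sumLt-+ (suc n) f g = trans (+-cong (sumLt-+ n f g) refl) (interchange _ _ _ _)
    where interchange = solve 4 (λ a b x y → (a :+ b) :+ (x :+ y) := (a :+ x) :+ (b :+ y)) refl

  sumLt-*ˡ : ∀ n x (f : ℕ → Carrier) → x * sumLt n f ≈ sumLt n (λ i → x * f i)
  sumLt-*ˡ zero    x f = zeroʳ x
  sumLt-*ˡ (suc n) x f = trans (distribˡ x _ _) (+-cong (sumLt-*ˡ n x f) refl)

  sumLt-*ʳ : ∀ n x (f : ℕ → Carrier) → sumLt n f * x ≈ sumLt n (λ i → f i * x)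
  sumLt-*ʳ zero    x f = zeroˡ x
  sumLt-*ʳ (suc n) x f = trans (distribʳ x _ _) (+-cong (sumLt-*ʳ n x f) refl)

  sumLt²-*ˡ : ∀ m n x (f : ℕ → ℕ → Carrier) →
    x * sumLt m (λ i → sumLt n (f i)) ≈ sumLt m (λ i → sumLt n (λ j → x * f i j))
  sumLt²-*ˡ m n x f = trans (sumLt-*ˡ m x _) (sumLt-cong m (λ i → sumLt-*ˡ n x (f i)))

  sumLt²-*ʳ : ∀ m n x (f : ℕ → ℕ → Carrier) →
    sumLt m (λ i → sumLt n (f i)) * x ≈ sumLt m (λ i → sumLt n (λ j → f i j * x))
  sumLt²-*ʳ m n x f = trans (sumLt-*ʳ m x _) (sumLt-cong m (λ i → sumLt-*ʳ n x (f i)))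

  sumLt-swap : ∀ m n (f : ℕ → ℕ → Carrier) →
    sumLt m (λ i → sumLt n (f i)) ≈ sumLt n (λ j → sumLt m (λ i → f i j))
  sumLt-swap zero    n f = sym (sumLt-vanishes n (λ _ _ → refl))
  sumLt-swap (suc m) n f =
    trans (+-cong (sumLt-swap m n f) refl) (sym (sumLt-+ n (λ j → sumLt m (λ i → f i j)) (f m)))

  sumLt-rotate : ∀ n (f : ℕ → ℕ → ℕ → Carrier) →
    sumLt n (λ x → sumLt n (λ y → sumLt n (f x y)))
      ≈ sumLt n (λ y → sumLt n (λ z → sumLt n (λ x → f x y z)))
  sumLt-rotate n f = trans (sumLt-swap n n _) (sumLt-cong n (λ y → sumLt-swap n n _))

  sumLt-extend : ∀ m n {f : ℕ → Carrier} → m ≤ n → (∀ i → m ≤ i → i < n → f i ≈ 0#) →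
    sumLt n f ≈ sumLt m f
  sumLt-extend m zero    z≤n f≈0 = refl
  sumLt-extend m (suc n) m≤1+n f≈0 with m ≟ suc n
  ... | yes P.refl = refl
  ... | no m≢1+n = trans (+-cong (sumLt-extend m n m≤n (λ i m≤i i<n → f≈0 i m≤i (ℕ.m<n⇒m<1+n i<n)))
                                 (f≈0 n m≤n (ℕ.n<1+n n)))
                         (+-identityʳ _)
    where m≤n = s≤s⁻¹ (ℕ.≤∧≢⇒< m≤1+n m≢1+n)

  sumLt-head : ∀ n (f : ℕ → Carrier) → sumLt (suc n) f ≈ f 0 + sumLt n (λ i → f (suc i))
  sumLt-head zero    f = +-comm _ _
  sumLt-head (suc n) f = trans (+-cong (sumLt-head n f) refl) (+-assoc _ _ _)

  sumLt-split : ∀ k m (f : ℕ → Carrier) → sumLt (k +ℕ m) f ≈ sumLt k f + sumLt m (λ i → f (k +ℕ i))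
  sumLt-split k zero    f rewrite ℕ.+-identityʳ k = sym (+-identityʳ _)
  sumLt-split k (suc m) f rewrite ℕ.+-suc k m =
    trans (+-cong (sumLt-split k m f) refl) (+-assoc _ _ _)

  δ : ℕ → ℕ → Carrier
  δ a b with a ≟ b
  ... | yes _ = 1#
  ... | no  _ = 0#

  δ-refl : ∀ a → δ a a ≈ 1#
  δ-refl a with a ≟ a
  ... | yes _   = refl
  ... | no  a≢a = ⊥-elim (a≢a P.refl)

  δ-≢ : ∀ {a b} → ¬ a ≡ b → δ a b ≈ 0#
  δ-≢ {a} {b} a≢b with a ≟ b
  ... | yes a≡b = ⊥-elim (a≢b a≡b)
  ... | no  _   = refl

  δ-cong-⇔ : ∀ {a b c d} → (a ≡ b → c ≡ d) → (c ≡ d → a ≡ b) → δ a b ≈ δ c d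
  δ-cong-⇔ {a} {b} {c} {d} to from with a ≟ b | c ≟ d
  ... | yes _   | yes _   = refl
  ... | no  _   | no  _   = refl
  ... | yes a≡b | no  c≢d = ⊥-elim (c≢d (to a≡b))
  ... | no  a≢b | yes c≡d = ⊥-elim (a≢b (from c≡d))

  δ-*-vanishes : ∀ {a b} → ¬ a ≡ b → ∀ x → δ a b * x ≈ 0#
  δ-*-vanishes a≢b x = trans (*-cong (δ-≢ a≢b) refl) (zeroˡ x)

  δ-+-vanishes : ∀ {t} c n → suc n ≤ t → ∀ x → δ (t +ℕ c) n * x ≈ 0#
  δ-+-vanishes {t} c n n<t = δ-*-vanishes (λ t+c≡n →
    ℕ.<-irrefl (P.sym t+c≡n) (ℕ.<-≤-trans n<t (ℕ.m≤m+n t c)))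

  sumLt-δ : ∀ n t (g : ℕ → Carrier) → (n ≤ t → g t ≈ 0#) → sumLt n (λ a → δ t a * g a) ≈ g t
  sumLt-δ zero    t g gₜ≈0 = sym (gₜ≈0 z≤n)
  sumLt-δ (suc n) t g gₜ≈0 = by-cases (t ≟ n)
    where
    by-cases : Dec (t ≡ n) → sumLt (suc n) (λ a → δ t a * g a) ≈ g t
    by-cases (yes P.refl) = begin
      sumLt t (λ a → δ t a * g a) + δ t t * g t
        ≈⟨ +-cong (sumLt-vanishes t (λ a a<t → δ-*-vanishes (λ t≡a → ℕ.<-irrefl (P.sym t≡a) a<t) _))
                  (trans (*-cong (δ-refl t) refl) (*-identityˡ _)) ⟩
      0# + g t ≈⟨ +-identityˡ _ ⟩
      g t      ∎
    by-cases (no t≢n) =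
      trans (+-cong (sumLt-δ n t g (λ n≤t → gₜ≈0 (ℕ.≤∧≢⇒< n≤t (λ n≡t → t≢n (P.sym n≡t)))))
                    (δ-*-vanishes t≢n _))
            (+-identityʳ _)

  infix 4 _≋_
  _≋_ : Series → Series → Set ℓ
  F ≋ G = ∀ n → F n ≈ G n

  mul-cong : ∀ {F F′ H H′} → F ≋ F′ → H ≋ H′ → mul F H ≋ mul F′ H′
  mul-cong F≋F′ H≋H′ n = sumLt-cong (suc n) (λ i → *-cong (F≋F′ i) (H≋H′ (n ∸ i)))

  pow-cong : ∀ {F F′} → F ≋ F′ → ∀ k → pow F k ≋ pow F′ k
  pow-cong F≋F′ zero    n = refl
  pow-cong F≋F′ (suc k)   = mul-cong F≋F′ (pow-cong F≋F′ k)

  minus1-cong : ∀ {F F′} → F ≋ F′ → minus1 F ≋ minus1 F′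
  minus1-cong F≋F′ zero    = +-cong (F≋F′ 0) refl
  minus1-cong F≋F′ (suc n) = F≋F′ (suc n)

  log1p-cong : ∀ {F F′} → F ≋ F′ → log1p F ≋ log1p F′
  log1p-cong F≋F′ n = sumLt-cong n (λ m → *-cong refl (*-cong refl (pow-cong F≋F′ (suc m) n)))

  minus1-0 : ∀ F → F 0 ≈ 1# → minus1 F 0 ≈ 0#
  minus1-0 F F₀≈1 = trans (+-cong F₀≈1 refl) (-‿inverseʳ 1#)

  mul-identityˡ : ∀ F → mul one F ≋ F
  mul-identityˡ F n = begin
    mul one F n                                       ≈⟨ sumLt-head n _ ⟩
    1# * F n + sumLt n (λ i → 0# * F (n ∸ suc i))     ≈⟨ +-cong (*-identityˡ _) (sumLt-vanishes n (λ i _ → zeroˡ _)) ⟩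
    F n + 0#                                          ≈⟨ +-identityʳ _ ⟩
    F n                                               ∎

  mul-identityʳ : ∀ F → mul F one ≋ F
  mul-identityʳ F n = begin
    sumLt n (λ i → F i * one (n ∸ i)) + F n * one (n ∸ n)
      ≈⟨ +-cong (sumLt-vanishes n (λ i i<n → trans (*-cong refl (one-pos (ℕ.m<n⇒0<n∸m i<n))) (zeroʳ _)))
                (*-cong refl (one-0 (ℕ.n∸n≡0 n))) ⟩
    0# + F n * 1# ≈⟨ trans (+-identityˡ _) (*-identityʳ _) ⟩
    F n           ∎
    where
    one-pos : ∀ {k} → 0 < k → one k ≈ 0#
    one-pos {suc k} _ = refl
    one-0 : ∀ {k} → k ≡ 0 → one k ≈ 1#
    one-0 P.refl = refl

  pow-vanishes-below : ∀ {G} → G 0 ≈ 0# → ∀ m n → n < m → pow G m n ≈ 0#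
  pow-vanishes-below G₀≈0 (suc m) n n<1+m = sumLt-vanishes (suc n) term≈0
    where
    term≈0 : ∀ i → i < suc n → _ * pow _ m (n ∸ i) ≈ 0#
    term≈0 zero    _     = trans (*-cong G₀≈0 refl) (zeroˡ _)
    term≈0 (suc i) i<n+1 = trans (*-cong refl (pow-vanishes-below G₀≈0 m (n ∸ suc i)
      (ℕ.<-≤-trans (ℕ.∸-monoʳ-< {n} {suc i} {0} (s≤s z≤n) (s≤s⁻¹ i<n+1)) (s≤s⁻¹ n<1+m)))) (zeroʳ _)

  -- Writing products as sums over a box [0, N)² cut out by δ (i + j) n lets all index
  -- manipulations below be done by swapping sums over a common range.
  mul-box : ∀ N n F H → n < N →
    mul F H n ≈ sumLt N (λ i → sumLt N (λ j → δ (i +ℕ j) n * (F i * H j)))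
  mul-box N n F H n<N = sym (begin
    sumLt N row       ≈⟨ sumLt-extend (suc n) N n<N (λ i n<i _ → sumLt-vanishes N (λ j _ → δ-+-vanishes j n n<i _)) ⟩
    sumLt (suc n) row ≈⟨ sumLt-cong-< (suc n) (λ i i<1+n → row≈ i (s≤s⁻¹ i<1+n)) ⟩
    mul F H n         ∎)
    where
    row : ℕ → Carrier
    row i = sumLt N (λ j → δ (i +ℕ j) n * (F i * H j))
    row≈ : ∀ i → i ≤ n → row i ≈ F i * H (n ∸ i)
    row≈ i i≤n = trans
      (sumLt-cong N (λ j → *-cong (δ-cong-⇔ (λ i+j≡n → P.trans (P.cong (_∸ i) (P.sym i+j≡n)) (ℕ.m+n∸m≡n i j))
                                             (λ n∸i≡j → P.trans (P.cong (i +ℕ_) (P.sym n∸i≡j)) (ℕ.m+[n∸m]≡n i≤n)))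
                                  refl))
      (sumLt-δ N (n ∸ i) (λ j → F i * H j)
         (λ N≤n∸i → ⊥-elim (ℕ.<-irrefl P.refl (ℕ.≤-<-trans N≤n∸i (ℕ.≤-<-trans (ℕ.m∸n≤m n i) n<N)))))

  mul-mulˡ-box : ∀ F G H n → let N = suc n in
    mul (mul F G) H n ≈ sumLt N (λ i → sumLt N (λ j → sumLt N (λ k → δ (i +ℕ j +ℕ k) n * ((F i * G j) * H k))))
  mul-mulˡ-box F G H n = begin
    mul (mul F G) H n
      ≈⟨ mul-box N n _ _ (ℕ.n<1+n n) ⟩
    sumLt N (λ a → sumLt N (λ k → δ (a +ℕ k) n * (mul F G a * H k)))
      ≈⟨ sumLt-cong-< N (λ a a<N → sumLt-cong N (λ k → *-cong refl (*-cong (mul-box N a F G a<N) refl))) ⟩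
    sumLt N (λ a → sumLt N (λ k → δ (a +ℕ k) n * (sumLt N (λ i → sumLt N (λ j → δ (i +ℕ j) a * (F i * G j))) * H k)))
      ≈⟨ sumLt-cong N (λ a → sumLt-cong N (λ k → trans (*-cong refl (sumLt²-*ʳ N N (H k) _))
           (trans (sumLt²-*ˡ N N _ _) (sumLt-cong N (λ i → sumLt-cong N (λ j → reorder _ _ _ _)))))) ⟩
    sumLt N (λ a → sumLt N (λ k → sumLt N (λ i → sumLt N (λ j → δ (i +ℕ j) a * (δ (a +ℕ k) n * ((F i * G j) * H k))))))
      ≈⟨ trans (sumLt-cong N (λ a → sumLt-rotate N _)) (sumLt-rotate N _) ⟩
    sumLt N (λ i → sumLt N (λ j → sumLt N (λ a → sumLt N (λ k → δ (i +ℕ j) a * (δ (a +ℕ k) n * ((F i * G j) * H k))))))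
      ≈⟨ sumLt-cong N (λ i → sumLt-cong N (λ j → trans (sumLt-swap N N _) (sumLt-cong N (λ k →
           sumLt-δ N (i +ℕ j) _ (λ N≤i+j → δ-+-vanishes k n N≤i+j _))))) ⟩
    sumLt N (λ i → sumLt N (λ j → sumLt N (λ k → δ (i +ℕ j +ℕ k) n * ((F i * G j) * H k)))) ∎
    where
    N = suc n
    reorder = solve 4 (λ x d y h → x :* ((d :* y) :* h) := d :* (x :* (y :* h))) refl

  mul-mulʳ-box : ∀ F G H n → let N = suc n in
    mul F (mul G H) n ≈ sumLt N (λ i → sumLt N (λ j → sumLt N (λ k → δ (i +ℕ j +ℕ k) n * ((F i * G j) * H k))))
  mul-mulʳ-box F G H n = begin
    mul F (mul G H) n
      ≈⟨ mul-box N n _ _ (ℕ.n<1+n n) ⟩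
    sumLt N (λ i → sumLt N (λ b → δ (i +ℕ b) n * (F i * mul G H b)))
      ≈⟨ sumLt-cong N (λ i → sumLt-cong-< N (λ b b<N → *-cong refl (*-cong refl (mul-box N b G H b<N)))) ⟩
    sumLt N (λ i → sumLt N (λ b → δ (i +ℕ b) n * (F i * sumLt N (λ j → sumLt N (λ k → δ (j +ℕ k) b * (G j * H k))))))
      ≈⟨ sumLt-cong N (λ i → sumLt-cong N (λ b → trans (*-cong refl (sumLt²-*ˡ N N (F i) _))
           (trans (sumLt²-*ˡ N N _ _) (sumLt-cong N (λ j → sumLt-cong N (λ k → reorder _ _ _ _)))))) ⟩
    sumLt N (λ i → sumLt N (λ b → sumLt N (λ j → sumLt N (λ k → δ (j +ℕ k) b * (δ (i +ℕ b) n * (F i * (G j * H k)))))))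
      ≈⟨ sumLt-cong N (λ i → sumLt-rotate N _) ⟩
    sumLt N (λ i → sumLt N (λ j → sumLt N (λ k → sumLt N (λ b → δ (j +ℕ k) b * (δ (i +ℕ b) n * (F i * (G j * H k)))))))
      ≈⟨ sumLt-cong N (λ i → sumLt-cong N (λ j → sumLt-cong N (λ k → sumLt-δ N (j +ℕ k) _
           (λ N≤j+k → trans (*-cong (δ-cong-⇔ (P.trans (ℕ.+-comm (j +ℕ k) i)) (P.trans (ℕ.+-comm i (j +ℕ k)))) refl)
                            (δ-+-vanishes i n N≤j+k _))))) ⟩
    sumLt N (λ i → sumLt N (λ j → sumLt N (λ k → δ (i +ℕ (j +ℕ k)) n * (F i * (G j * H k)))))
      ≈⟨ sumLt-cong N (λ i → sumLt-cong N (λ j → sumLt-cong N (λ k →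
           *-cong (δ-cong-⇔ (P.trans (ℕ.+-assoc i j k)) (P.trans (P.sym (ℕ.+-assoc i j k)))) (sym (*-assoc _ _ _))))) ⟩
    sumLt N (λ i → sumLt N (λ j → sumLt N (λ k → δ (i +ℕ j +ℕ k) n * ((F i * G j) * H k)))) ∎
    where
    N = suc n
    reorder = solve 4 (λ x f d y → x :* (f :* (d :* y)) := d :* (x :* (f :* y))) refl

  mul-assoc : ∀ F G H → mul (mul F G) H ≋ mul F (mul G H)
  mul-assoc F G H n = trans (mul-mulˡ-box F G H n) (sym (mul-mulʳ-box F G H n))

  pow-+ : ∀ G i j → pow G (i +ℕ j) ≋ mul (pow G i) (pow G j)
  pow-+ G zero    j n = sym (mul-identityˡ (pow G j) n)
  pow-+ G (suc i) j n =
    trans (mul-cong (λ _ → refl) (pow-+ G i j) n) (sym (mul-assoc G (pow G i) (pow G j) n))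

  comp-extend : ∀ F {G} → G 0 ≈ 0# → ∀ N a → a < N → comp F G a ≈ sumLt N (λ i → F i * pow G i a)
  comp-extend F G₀≈0 N a a<N = sym (sumLt-extend (suc a) N a<N
    (λ i a<i _ → trans (*-cong refl (pow-vanishes-below G₀≈0 i a a<i)) (zeroʳ _)))

  comp-mul-box : ∀ F H {G} → G 0 ≈ 0# → ∀ n → let N = suc n in
    comp (mul F H) G n ≈ sumLt N (λ i → sumLt N (λ j → (F i * H j) * pow G (i +ℕ j) n))
  comp-mul-box F H {G} G₀≈0 n = begin
    sumLt N (λ m → mul F H m * pow G m n)
      ≈⟨ sumLt-cong-< N (λ m m<N → *-cong (mul-box N m F H m<N) refl) ⟩
    sumLt N (λ m → sumLt N (λ i → sumLt N (λ j → δ (i +ℕ j) m * (F i * H j))) * pow G m n)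
      ≈⟨ sumLt-cong N (λ m → trans (sumLt²-*ʳ N N _ _) (sumLt-cong N (λ i → sumLt-cong N (λ j → *-assoc _ _ _)))) ⟩
    sumLt N (λ m → sumLt N (λ i → sumLt N (λ j → δ (i +ℕ j) m * ((F i * H j) * pow G m n))))
      ≈⟨ sumLt-rotate N _ ⟩
    sumLt N (λ i → sumLt N (λ j → sumLt N (λ m → δ (i +ℕ j) m * ((F i * H j) * pow G m n))))
      ≈⟨ sumLt-cong N (λ i → sumLt-cong N (λ j → sumLt-δ N (i +ℕ j) _
           (λ N≤i+j → trans (*-cong refl (pow-vanishes-below G₀≈0 (i +ℕ j) n N≤i+j)) (zeroʳ _)))) ⟩
    sumLt N (λ i → sumLt N (λ j → (F i * H j) * pow G (i +ℕ j) n)) ∎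
    where N = suc n

  mul-comp-box : ∀ F H {G} → G 0 ≈ 0# → ∀ n → let N = suc n in
    mul (comp F G) (comp H G) n ≈ sumLt N (λ i → sumLt N (λ j → (F i * H j) * pow G (i +ℕ j) n))
  mul-comp-box F H {G} G₀≈0 n = begin
    mul (comp F G) (comp H G) n
      ≈⟨ mul-box N n _ _ (ℕ.n<1+n n) ⟩
    sumLt N (λ a → sumLt N (λ b → δ (a +ℕ b) n * (comp F G a * comp H G b)))
      ≈⟨ sumLt-cong-< N (λ a a<N → sumLt-cong-< N (λ b b<N →
           *-cong refl (*-cong (comp-extend F G₀≈0 N a a<N) (comp-extend H G₀≈0 N b b<N)))) ⟩
    sumLt N (λ a → sumLt N (λ b → δ (a +ℕ b) n * (sumLt N (λ i → F i * pow G i a) * sumLt N (λ j → H j * pow G j b))))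
      ≈⟨ sumLt-cong N (λ a → sumLt-cong N (λ b →
           trans (*-cong refl (trans (sumLt-*ʳ N _ _) (sumLt-cong N (λ i → sumLt-*ˡ N _ _))))
                 (trans (sumLt²-*ˡ N N _ _) (sumLt-cong N (λ i → sumLt-cong N (λ j → reorder _ _ _ _ _)))))) ⟩
    sumLt N (λ a → sumLt N (λ b → sumLt N (λ i → sumLt N (λ j → (F i * H j) * (δ (a +ℕ b) n * (pow G i a * pow G j b))))))
      ≈⟨ trans (sumLt-cong N (λ a → sumLt-rotate N _)) (sumLt-rotate N _) ⟩
    sumLt N (λ i → sumLt N (λ j → sumLt N (λ a → sumLt N (λ b → (F i * H j) * (δ (a +ℕ b) n * (pow G i a * pow G j b))))))
      ≈⟨ sumLt-cong N (λ i → sumLt-cong N (λ j → sym (sumLt²-*ˡ N N _ _))) ⟩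
    sumLt N (λ i → sumLt N (λ j → (F i * H j) * sumLt N (λ a → sumLt N (λ b → δ (a +ℕ b) n * (pow G i a * pow G j b)))))
      ≈⟨ sumLt-cong N (λ i → sumLt-cong N (λ j → *-cong refl
           (trans (sym (mul-box N n (pow G i) (pow G j) (ℕ.n<1+n n))) (sym (pow-+ G i j n))))) ⟩
    sumLt N (λ i → sumLt N (λ j → (F i * H j) * pow G (i +ℕ j) n)) ∎
    where
    N = suc n
    reorder = solve 5 (λ x f q h r → x :* ((f :* q) :* (h :* r)) := (f :* h) :* (x :* (q :* r))) refl

  comp-mul : ∀ F H {G} → G 0 ≈ 0# → comp (mul F H) G ≋ mul (comp F G) (comp H G)
  comp-mul F H G₀≈0 n = trans (comp-mul-box F H G₀≈0 n) (sym (mul-comp-box F H G₀≈0 n))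

  comp-one : ∀ G → comp one G ≋ one
  comp-one G n = begin
    comp one G n                                        ≈⟨ sumLt-head n _ ⟩
    1# * one n + sumLt n (λ m → 0# * pow G (suc m) n)   ≈⟨ +-cong (*-identityˡ _) (sumLt-vanishes n (λ _ _ → zeroˡ _)) ⟩
    one n + 0#                                          ≈⟨ +-identityʳ _ ⟩
    one n                                               ∎

  comp-pow : ∀ F {G} → G 0 ≈ 0# → ∀ k → comp (pow F k) G ≋ pow (comp F G) k
  comp-pow F {G} G₀≈0 zero      = comp-one G
  comp-pow F     G₀≈0 (suc k) n =
    trans (comp-mul F (pow F k) G₀≈0 n) (mul-cong (λ _ → refl) (comp-pow F G₀≈0 k) n)

  comp-log1p : ∀ {F G} → F 0 ≈ 0# → G 0 ≈ 0# → log1p (comp F G) ≋ comp (log1p F) G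
  comp-log1p {F} {G} F₀≈0 G₀≈0 n = trans lhs≈ (sym rhs≈)
    where
    term : ℕ → ℕ → Carrier
    term m j = alt m * (inv (suc m) * pow F (suc m) j)
    reassoc = solve 4 (λ a b p q → a :* (b :* (p :* q)) := (a :* (b :* p)) :* q) refl
    lhs≈ : log1p (comp F G) n ≈ sumLt n (λ m → sumLt (suc n) (λ j → term m j * pow G j n))
    lhs≈ = sumLt-cong n (λ m → begin
      alt m * (inv (suc m) * pow (comp F G) (suc m) n)
        ≈⟨ *-cong refl (*-cong refl (sym (comp-pow F G₀≈0 (suc m) n))) ⟩
      alt m * (inv (suc m) * sumLt (suc n) (λ j → pow F (suc m) j * pow G j n))
        ≈⟨ trans (*-cong refl (sumLt-*ˡ (suc n) _ _)) (sumLt-*ˡ (suc n) _ _) ⟩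
      sumLt (suc n) (λ j → alt m * (inv (suc m) * (pow F (suc m) j * pow G j n)))
        ≈⟨ sumLt-cong (suc n) (λ j → reassoc _ _ _ _) ⟩
      sumLt (suc n) (λ j → term m j * pow G j n) ∎)
    -- log1p F j only sums m < j, but the terms with j ≤ m vanish, so both sides range over m < n.
    rhs≈ : comp (log1p F) G n ≈ sumLt n (λ m → sumLt (suc n) (λ j → term m j * pow G j n))
    rhs≈ = begin
      sumLt (suc n) (λ j → log1p F j * pow G j n)
        ≈⟨ sumLt-cong-< (suc n) (λ j j<1+n → *-cong (sym (sumLt-extend j n (s≤s⁻¹ j<1+n)
             (λ m j≤m _ → trans (*-cong refl (trans (*-cong refl (pow-vanishes-below F₀≈0 (suc m) j (s≤s j≤m)))
                                                    (zeroʳ _)))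
                                (zeroʳ _)))) refl) ⟩
      sumLt (suc n) (λ j → sumLt n (λ m → term m j) * pow G j n)
        ≈⟨ sumLt-cong (suc n) (λ j → sumLt-*ʳ n _ _) ⟩
      sumLt (suc n) (λ j → sumLt n (λ m → term m j * pow G j n))
        ≈⟨ sym (sumLt-swap n (suc n) _) ⟩
      sumLt n (λ m → sumLt (suc n) (λ j → term m j * pow G j n)) ∎

  ι-inv : ∀ {k} → 0 < k → ιR k * inv k ≈ 1#
  ι-inv {suc k} _ = inv-spec k

  comp-expansion : ∀ H G n k → (∀ j → j < k → H j ≈ 0#) → k ≤ n →
    ιR (n !) * (inv (k !) * comp H G n)
      ≈ sumFromTo k n (λ j → (ιR (n !) * (inv (j !) * pow G j n)) * (ιR (j !) * (inv (k !) * H j)))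
  comp-expansion H G n k H≈0 k≤n = begin
    ιR (n !) * (inv (k !) * sumLt (suc n) (λ j → H j * pow G j n))
      ≈⟨ trans (*-cong refl (sumLt-*ˡ (suc n) _ _)) (sumLt-*ˡ (suc n) _ _) ⟩
    sumLt (suc n) (λ j → ιR (n !) * (inv (k !) * (H j * pow G j n)))
      ≈⟨ sumLt-cong (suc n) (λ j → sym (term≈ j)) ⟩
    sumLt (suc n) term
      ≈⟨ sumLt-≡ term (P.trans (P.cong suc (P.sym (ℕ.m+[n∸m]≡n k≤n))) (P.sym (ℕ.+-suc k (n ∸ k)))) ⟩
    sumLt (k +ℕ suc (n ∸ k)) term
      ≈⟨ sumLt-split k (suc (n ∸ k)) term ⟩
    sumLt k term + sumLt (suc (n ∸ k)) (λ i → term (k +ℕ i))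
      ≈⟨ trans (+-cong (sumLt-vanishes k term≈0) refl) (+-identityˡ _) ⟩
    sumLt (suc (n ∸ k)) (λ i → term (k +ℕ i)) ∎
    where
    term : ℕ → Carrier
    term j = (ιR (n !) * (inv (j !) * pow G j n)) * (ιR (j !) * (inv (k !) * H j))
    reorder = solve 6 (λ a i q f b h → (a :* (i :* q)) :* (f :* (b :* h)) := (a :* (b :* (h :* q))) :* (f :* i)) refl
    term≈ : ∀ j → term j ≈ ιR (n !) * (inv (k !) * (H j * pow G j n))
    term≈ j = trans (reorder _ _ _ _ _ _) (trans (*-cong refl (ι-inv (ℕ.1≤n! j))) (*-identityʳ _))
    term≈0 : ∀ j → j < k → term j ≈ 0#
    term≈0 j j<k = trans (term≈ j)
      (trans (*-cong refl (trans (*-cong refl (trans (*-cong (H≈0 j j<k) refl) (zeroˡ _))) (zeroʳ _))) (zeroʳ _))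

  minus1-∘ₛ : ∀ B C → minus1 (B ∘ₛ C) ≋ comp (minus1 B) (minus1 C)
  minus1-∘ₛ B C zero    = begin
    (0# + B 0 * 1#) - 1#   ≈⟨ +-cong (+-identityˡ _) refl ⟩
    B 0 * 1# - 1#          ≈⟨ sym (trans (distribʳ 1# _ _) (+-cong refl (*-identityʳ _))) ⟩
    (B 0 - 1#) * 1#        ≈⟨ sym (+-identityˡ _) ⟩
    0# + (B 0 - 1#) * 1#   ∎
  minus1-∘ₛ B C (suc n) = begin
    comp B (minus1 C) (suc n)                     ≈⟨ sumLt-head (suc n) _ ⟩
    B 0 * 0# + _                                  ≈⟨ +-cong (trans (zeroʳ _) (sym (zeroʳ _))) refl ⟩
    (B 0 - 1#) * 0# + _                           ≈⟨ sym (sumLt-head (suc n) _) ⟩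
    comp (minus1 B) (minus1 C) (suc n)            ∎

  logS-∘ₛ : ∀ {B C} → B 0 ≈ 1# → C 0 ≈ 1# → logS (B ∘ₛ C) ≋ comp (logS B) (minus1 C)
  logS-∘ₛ {B} {C} B₀≈1 C₀≈1 n =
    trans (log1p-cong (minus1-∘ₛ B C) n) (comp-log1p (minus1-0 B B₀≈1) (minus1-0 C C₀≈1) n)

  onePlusZ-∘ₛ : ∀ {C} → C 0 ≈ 1# → onePlusZ ∘ₛ C ≋ C
  onePlusZ-∘ₛ C₀≈1 zero    = trans (+-identityˡ _) (trans (*-identityˡ _) (sym C₀≈1))
  onePlusZ-∘ₛ {C} C₀≈1 (suc n) = begin
    comp onePlusZ (minus1 C) (suc n)
      ≈⟨ sumLt-extend 2 (suc (suc n)) (s≤s (s≤s z≤n)) (λ i 2≤i _ → high≈0 i 2≤i) ⟩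
    (0# + 1# * 0#) + 1# * mul (minus1 C) one (suc n)
      ≈⟨ +-cong (trans (+-identityˡ _) (zeroʳ _)) (trans (*-identityˡ _) (mul-identityʳ (minus1 C) (suc n))) ⟩
    0# + C (suc n) ≈⟨ +-identityˡ _ ⟩
    C (suc n)      ∎
    where
    high≈0 : ∀ i → 2 ≤ i → onePlusZ i * pow (minus1 C) i (suc n) ≈ 0#
    high≈0 (suc zero)    (s≤s ())
    high≈0 (suc (suc i)) _ = zeroˡ _

  sF-cong : ∀ {F F′} → F ≋ F′ → ∀ n k → sF F n k ≈ sF F′ n k
  sF-cong F≋F′ n k = *-cong refl (*-cong refl (pow-cong (log1p-cong (minus1-cong F≋F′)) k n))

  factorial-comp-pow : ∀ {F G} → F 0 ≈ 0# → G 0 ≈ 0# → ∀ {P} → P ≋ comp F G → ∀ n k → k ≤ n →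
    ιR (n !) * (inv (k !) * pow P k n)
      ≈ sumFromTo k n (λ j → (ιR (n !) * (inv (j !) * pow G j n)) * (ιR (j !) * (inv (k !) * pow F k j)))
  factorial-comp-pow {F} F₀≈0 G₀≈0 P≋F∘G n k k≤n =
    trans (*-cong refl (*-cong refl (trans (pow-cong P≋F∘G k n) (sym (comp-pow F G₀≈0 k n)))))
          (comp-expansion (pow F k) _ n k (λ j j<k → pow-vanishes-below F₀≈0 k j j<k) k≤n)

theorem6 : ∀ {c ℓ : Level} (A : QAlgebra c ℓ) → let open FPS A in
    (B C : Series) → B 0 ≈ 1# → C 0 ≈ 1# →
    (n k : ℕ) → k ≤ n →
      (sF (B ∘ₛ C) n k ≈ sumFromTo k n (λ j → SF C n j * sF B j k))
      × (SF (B ∘ₛ C) n k ≈ sumFromTo k n (λ j → SF C n j * SF B j k))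
      × (sF C n k ≈ sumFromTo k n (λ j → SF C n j * s j k))
theorem6 A B C B₀≈1 C₀≈1 n k k≤n = stirling₁ B B₀≈1 , stirling₂ , stirling₁-log
  where
  open FPS A
  open Composition A
  open CommutativeRing ring using (refl; sym; trans)
  stirling₁ : ∀ B → B 0 ≈ 1# → sF (B ∘ₛ C) n k ≈ sumFromTo k n (λ j → SF C n j * sF B j k)
  stirling₁ B B₀≈1 = factorial-comp-pow refl (minus1-0 C C₀≈1) (logS-∘ₛ B₀≈1 C₀≈1) n k k≤n
  stirling₂ : SF (B ∘ₛ C) n k ≈ sumFromTo k n (λ j → SF C n j * SF B j k)
  stirling₂ = factorial-comp-pow (minus1-0 B B₀≈1) (minus1-0 C C₀≈1) (minus1-∘ₛ B C) n k k≤n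
  stirling₁-log : sF C n k ≈ sumFromTo k n (λ j → SF C n j * s j k)
  stirling₁-log = trans (sym (sF-cong (onePlusZ-∘ₛ C₀≈1) n k)) (stirling₁ onePlusZ refl)
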